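{- For every odd positive integer $n$, the ARS matching $\Xi_n$ is a rainbow near-perfect matching in $K^\bullet_n$, i.e. a set of $(n-1)/2$ pairwise vertex-disjoint edges of $K^\bullet_n$ having pairwise distinct colors.
   Context: For an integer $n\ge 1$, $K^\bullet_n$ denotes the complete graph on vertex set $\{0,1,\ldots,n-1\}$ whose edges are colored by the circular-distance edge coloring: the edge $\{i,j\}$ receives color $c_{\min\{|i-j|,\,n-|i-j|\}}$, where $c_1,c_2,\ldots$ are distinct colors; exactly $\lfloor n/2\rfloor$ colors are used. For odd $n$, a rainbow near-perfect matching is a matching with $(n-1)/2$ edges whose colors are pairwise distinct (exactly one vertex is unmatched). The ARS (arch-recursive-slide) matching $\Xi_n$, for odd $n\ge 1$, is defined recursively by $\Xi_n=\Xi'_n\cup\Xi''_n\cup\Xi'''_n$, where $\Xi'_1=\Xi''_1=\Xi'''_1=\emptyset$, and for $n\ge 3$ write $n=8k+r$ with $k\ge 0$ an integer and $r\in\{1,3,5,7\}$; then: $\Xi'_n=\{\{i,2k-1-i\}: i=0,\ldots,k-1\}$ if $r\in\{1,3\}$, and $\Xi'_n=\{\{i,2k+1-i\}: i=0,\ldots,k\}$ if $r\in\{5,7\}$; $\Xi''_n=\{\{2k+i,4k+1+2i\}: i=0,\ldots,2k-1\}$ if $r=1$; $\{\{2k+i,4k+1+2i\}: i=0,\ldots,2k\}$ if $r=3$; $\{\{2k+2+i,4k+4+2i\}: i=0,\ldots,2k\}$ if $r=5$; $\{\{2k+2+i,4k+4+2i\}: i=0,\ldots,2k+1\}$ if $r=7$;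 $\Xi'''_n=\{\{s+2i,\,s+2j\}: \{i,j\}\in \Xi_{2k+1}\}$ where $s=4k$ if $r=1$, $s=4k+2$ if $r=3$, $s=4k+3$ if $r=5$, $s=4k+5$ if $r=7$. (Index ranges with upper bound below the lower bound give the empty set.) -}

module Defs where

open import Data.Nat using (ℕ; zero; suc; _+_; _*_; _∸_; _⊓_; ∣_-_∣; _/_; _%_)
open import Data.Nat.Properties using ()
open import Data.Product using (_×_; _,_; proj₁; proj₂)
open import Data.List using (List; []; _∷_; _++_; map; upTo; length)
open import Data.List.Relation.Unary.All using (All)
open import Data.List.Relation.Unary.AllPairs using (AllPairs)
open import Relation.Binary.PropositionalEquality using (_≡_; _≢_)
open import Data.Nat using (_<_)

-- An edge {i,j} is represented by an ordered pair (i , j); all predicates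
-- below are symmetric in the two endpoints.
Edge : Set
Edge = ℕ × ℕ

colour : ℕ → Edge → ℕ
colour n (i , j) = ∣ i - j ∣ ⊓ (n ∸ ∣ i - j ∣)

IsEdge : ℕ → Edge → Set
IsEdge n (i , j) = (i < n) × (j < n) × (i ≢ j)

Disjoint : Edge → Edge → Set
Disjoint (a , b) (c , d) = (a ≢ c) × (a ≢ d) × (b ≢ c) × (b ≢ d)

IsRainbowNearPerfectMatching : ℕ → List Edge → Set
IsRainbowNearPerfectMatching n M =
  All (IsEdge n) M ×
  AllPairs (λ e f → Disjoint e f × colour n e ≢ colour n f) M ×
  length M ≡ (n ∸ 1) / 2

-- The ARS matching, computed with a fuel parameter (fuel ≥ n suffices,
-- since the recursive call is on 2k+1 < n for n ≥ 3).
ARSfuel : ℕ → ℕ → List Edge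
ARSfuel zero n = []
ARSfuel (suc f) zero = []
ARSfuel (suc f) (suc zero) = []
ARSfuel (suc f) n@(suc (suc _)) = go (n % 8)
  where
  k : ℕ
  k = n / 8
  shift : ℕ → List Edge
  shift s = map (λ e → (s + 2 * proj₁ e , s + 2 * proj₂ e)) (ARSfuel f (2 * k + 1))
  go : ℕ → List Edge
  go 1 = map (λ i → (i , 2 * k ∸ 1 ∸ i)) (upTo k)
      ++ map (λ i → (2 * k + i , 4 * k + 1 + 2 * i)) (upTo (2 * k))
      ++ shift (4 * k)
  go 3 = map (λ i → (i , 2 * k ∸ 1 ∸ i)) (upTo k)
      ++ map (λ i → (2 * k + i , 4 * k + 1 + 2 * i)) (upTo (2 * k + 1))
      ++ shift (4 * k + 2)
  go 5 = map (λ i → (i , 2 * k + 1 ∸ i)) (upTo (k + 1))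
      ++ map (λ i → (2 * k + 2 + i , 4 * k + 4 + 2 * i)) (upTo (2 * k + 1))
      ++ shift (4 * k + 3)
  go 7 = map (λ i → (i , 2 * k + 1 ∸ i)) (upTo (k + 1))
      ++ map (λ i → (2 * k + 2 + i , 4 * k + 4 + 2 * i)) (upTo (2 * k + 2))
      ++ shift (4 * k + 5)
  go _ = []

ARS : ℕ → List Edge
ARS n = ARSfuel n n

-- Write n = 2m + 1 = 8k + r. Every edge (a , b) of Ξ_n has a < b and span b − a ≤ m, so its colour
-- is its span, and it suffices to show that the edges are disjoint with distinct spans.
-- The three parts are kept apart by position and parity: the arch Ξ′ lives below 2p and has
-- odd spans < 2p; the slide Ξ″ has left ends in [2p, 2p + L), right ends in q + 2ℕ and
-- consecutive spans ≥ g, where g exceeds both 2p − 1 and 2k; and Ξ‴ is Ξ_{2k+1} dilated by 2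
-- into s + 2ℕ with s ≢ q (mod 2), so its spans are the even numbers ≤ 2k, distinct by induction.
{-# OPTIONS --safe #-}
module Submission where

open import Defs
open import Data.Nat using (ℕ; zero; suc; _+_; _*_; _∸_; _≤_; _<_; z≤n; s≤s; _⊓_; ∣_-_∣; _/_; _%_)
open import Data.Nat.Properties
open import Data.Nat.DivMod using (m≡m%n+[m/n]*n; m%n<n; m/n*n≤m; m*n/n≡m)
open import Data.Nat.Tactic.RingSolver using (solve)
open import Data.Product using (∃-syntax; _×_; _,_; proj₁; proj₂)
open import Data.Sum using (_⊎_; inj₁; inj₂)
open import Data.List using (List; []; _∷_; _++_; map; upTo; length)
open import Data.List.Properties using (length-++; length-map; length-upTo)
open import Data.List.Relation.Unary.All as All using (All)
import Data.List.Relation.Unary.All.Properties as All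
open import Data.List.Relation.Unary.AllPairs as AllPairs using (AllPairs)
import Data.List.Relation.Unary.AllPairs.Properties as AllPairs
open import Data.Empty using (⊥; ⊥-elim)
open import Function using (id; _∘_)
open import Relation.Binary.PropositionalEquality

m+o≡n⇒m≤n : ∀ {m n} o → m + o ≡ n → m ≤ n
m+o≡n⇒m≤n {m} o m+o≡n = subst (m ≤_) m+o≡n (m≤m+n m o)

allPairs-map-All : ∀ {A : Set} {P : A → Set} {R S : A → A → Set} →
                   (∀ {x y} → P x → P y → R x y → S x y) →
                   ∀ {xs} → All P xs → AllPairs R xs → AllPairs S xs
allPairs-map-All f All.[] AllPairs.[] = AllPairs.[]
allPairs-map-All f (px All.∷ pxs) (rx AllPairs.∷ rxs) =
  All.zipWith (λ (py , r) → f px py r) (pxs , rx) AllPairs.∷ allPairs-map-All f pxs rxs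

_∈2ℕ+_ : ℕ → ℕ → Set
x ∈2ℕ+ s = ∃[ y ] x ≡ s + 2 * y

∈2ℕ+⇒≥ : ∀ {x} s → x ∈2ℕ+ s → s ≤ x
∈2ℕ+⇒≥ s (y , refl) = m≤m+n s (2 * y)

∈2ℕ+-parity : ∀ {x} s → x ∈2ℕ+ s → x ∈2ℕ+ suc s → ⊥
∈2ℕ+-parity s (y , refl) (z , eq) =
  even≢odd y z (+-cancelˡ-≡ s (2 * y) (suc (2 * z)) (trans eq (sym (+-suc s (2 * z)))))

span : Edge → ℕ
span (a , b) = b ∸ a

Short : ℕ → Edge → Set
Short m (a , b) = a < b × b < 2 * m + 1 × b ∸ a ≤ m

Compatible : Edge → Edge → Set
Compatible e f = Disjoint e f × span e ≢ span f

ShortRainbow : ℕ → List Edge → Set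
ShortRainbow m M = All (Short m) M × AllPairs Compatible M × length M ≡ m

colour-short : ∀ {m} e → Short m e → colour (2 * m + 1) e ≡ span e
colour-short {m} (a , b) (a<b , _ , d≤m) = begin
  ∣ a - b ∣ ⊓ (2 * m + 1 ∸ ∣ a - b ∣)
    ≡⟨ cong (λ d → d ⊓ (2 * m + 1 ∸ d)) (m≤n⇒∣m-n∣≡n∸m (<⇒≤ a<b)) ⟩
  d ⊓ (2 * m + 1 ∸ d)
    ≡⟨ m≤n⇒m⊓n≡m (m+n≤o⇒m≤o∸n d d+d≤n) ⟩
  d ∎
  where
  open ≡-Reasoning
  d : ℕ
  d = b ∸ a
  d+d≤n : d + d ≤ 2 * m + 1
  d+d≤n = ≤-trans (+-mono-≤ d≤m d≤m) (m+o≡n⇒m≤n 1 (solve (m ∷ [])))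

short-below : ∀ {m a b} → a < b → b ≤ m → Short m (a , b)
short-below {m} {a} {b} a<b b≤m =
  a<b , ≤-trans (s≤s b≤m) (m+o≡n⇒m≤n m (solve (m ∷ []))) , ≤-trans (m∸n≤m b a) b≤m

separated : ∀ {a a′ c c′ t} → a < t → a′ < t → t ≤ c → t ≤ c′ → Disjoint (a , a′) (c , c′)
separated a<t a′<t t≤c t≤c′ =
  <⇒≢ (<-≤-trans a<t t≤c) , <⇒≢ (<-≤-trans a<t t≤c′) ,
  <⇒≢ (<-≤-trans a′<t t≤c) , <⇒≢ (<-≤-trans a′<t t≤c′)

shortRainbow⇒rainbowNearPerfect : ∀ {m M} → ShortRainbow m M →
                                  IsRainbowNearPerfectMatching (2 * m + 1) M
shortRainbow⇒rainbowNearPerfect {m} (short , compatible , length≡m) =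
  All.map (λ { (a<b , b<n , _) → <-trans a<b b<n , b<n , <⇒≢ a<b }) short ,
  allPairs-map-All rainbow short compatible ,
  trans length≡m (sym (half-even m))
  where
  rainbow : ∀ {e f} → Short m e → Short m f → Compatible e f →
            Disjoint e f × colour (2 * m + 1) e ≢ colour (2 * m + 1) f
  rainbow {e} {f} se sf (disjoint , span≢) =
    disjoint , λ eq → span≢ (trans (sym (colour-short e se)) (trans eq (colour-short f sf)))
  half-even : ∀ m → (2 * m + 1 ∸ 1) / 2 ≡ m
  half-even m = trans (cong (_/ 2) (trans (m+n∸n≡m (2 * m) 1) (*-comm 2 m))) (m*n/n≡m m 2)

arch : ℕ → ℕ → List Edge
arch c p = map (λ i → (i , c ∸ i)) (upTo p)

ArchZone : ℕ → Edge → Set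
ArchZone p (a , b) = a < b × b < 2 * p × (b ∸ a) ∈2ℕ+ 1

module _ {c p : ℕ} (apex : 0 < p → c + 1 ≡ 2 * p) where

  private
    apex-split : ∀ {i} → i < p → ∃[ u ] c ≡ (i + i) + suc (2 * u)
    apex-split {i} i<p with u , 1+i+u≡p ← m≤n⇒∃[o]m+o≡n i<p = u , +-cancelʳ-≡ 1 c _ (begin
      c + 1                      ≡⟨ apex (≤-<-trans z≤n i<p) ⟩
      2 * p                      ≡⟨ cong (2 *_) (sym 1+i+u≡p) ⟩
      2 * suc (i + u)            ≡⟨ solve (i ∷ u ∷ []) ⟩
      (i + i) + suc (2 * u) + 1  ∎)
      where open ≡-Reasoning

    2i<c : ∀ {i} → i < p → i + i < c
    2i<c {i} i<p with _ , c≡ ← apex-split i<p =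
      subst (i + i <_) (sym c≡) (m<m+n (i + i) (s≤s z≤n))

    arch-edge-zone : ∀ {i} → i < p → ArchZone p (i , c ∸ i)
    arch-edge-zone {i} i<p with u , c≡ ← apex-split i<p =
      m+n≤o⇒m≤o∸n (suc i) (2i<c i<p) ,
      ≤-<-trans (m∸n≤m c i) (subst (c <_) (apex (≤-<-trans z≤n i<p)) (m<m+n c (s≤s z≤n))) ,
      u , (begin
        c ∸ i ∸ i                        ≡⟨ ∸-+-assoc c i i ⟩
        c ∸ (i + i)                      ≡⟨ cong (_∸ (i + i)) c≡ ⟩
        (i + i) + suc (2 * u) ∸ (i + i)  ≡⟨ m+n∸m≡n (i + i) _ ⟩
        suc (2 * u)                      ∎)
      where open ≡-Reasoning

  arch-zone : All (ArchZone p) (arch c p)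
  arch-zone = All.map⁺ (All.applyUpTo⁺₁ id p arch-edge-zone)

  arch-compatible : AllPairs Compatible (arch c p)
  arch-compatible = AllPairs.map⁺ (AllPairs.applyUpTo⁺₁ id p compatible)
    where
    compatible : ∀ {i j} → i < j → j < p → Compatible (i , c ∸ i) (j , c ∸ j)
    compatible {i} {j} i<j j<p =
      (<⇒≢ i<j , <⇒≢ (<-trans i<j j<rⱼ) ,
       ≢-sym (<⇒≢ (<-trans j<rⱼ rⱼ<rᵢ)) , ≢-sym (<⇒≢ rⱼ<rᵢ)) ,
      ≢-sym (<⇒≢ spanⱼ<spanᵢ)
      where
      j<rⱼ : j < c ∸ j
      j<rⱼ = proj₁ (arch-edge-zone j<p)
      2j≤c : j + j ≤ c
      2j≤c = <⇒≤ (2i<c j<p)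
      rⱼ<rᵢ : c ∸ j < c ∸ i
      rⱼ<rᵢ = ∸-monoʳ-< i<j (≤-trans (m≤m+n j j) 2j≤c)
      spanⱼ<spanᵢ : c ∸ j ∸ j < c ∸ i ∸ i
      spanⱼ<spanᵢ = subst₂ _<_ (sym (∸-+-assoc c j j)) (sym (∸-+-assoc c i i))
                      (∸-monoʳ-< (+-mono-< i<j i<j) 2j≤c)

slide : ℕ → ℕ → ℕ → List Edge
slide b q L = map (λ i → (b + i , q + 2 * i)) (upTo L)

SlideZone : ℕ → ℕ → ℕ → ℕ → Edge → Set
SlideZone b L q g (a , a′) = b ≤ a × a < b + L × a′ ∈2ℕ+ q × g ≤ a′ ∸ a

module _ {b q g L : ℕ} (q≡b+g : q ≡ b + g) (L≤g : L ≤ g) where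

  private
    b+L≤q : b + L ≤ q
    b+L≤q = subst (b + L ≤_) (sym q≡b+g) (+-monoʳ-≤ b L≤g)

    slide-span : ∀ i → q + 2 * i ∸ (b + i) ≡ g + i
    slide-span i = begin
      q + 2 * i ∸ (b + i)            ≡⟨ cong (λ x → x + 2 * i ∸ (b + i)) q≡b+g ⟩
      b + g + 2 * i ∸ (b + i)        ≡⟨ cong (_∸ (b + i)) (solve (b ∷ g ∷ i ∷ [])) ⟩
      (b + i) + (g + i) ∸ (b + i)    ≡⟨ m+n∸m≡n (b + i) (g + i) ⟩
      g + i                          ∎
      where open ≡-Reasoning

  slide-zone : All (SlideZone b L q g) (slide b q L)
  slide-zone = All.map⁺ (All.applyUpTo⁺₁ id L λ {i} i<L →
    m≤m+n b i , +-monoʳ-< b i<L , (i , refl) , subst (g ≤_) (sym (slide-span i)) (m≤m+n g i))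

  slide-short : ∀ {m} → g + L ≤ suc m → q + 2 * L ≤ suc (2 * m + 1) → All (Short m) (slide b q L)
  slide-short {m} g+L≤1+m q+2L≤2m+2 = All.map⁺ (All.applyUpTo⁺₁ id L λ i<L →
    <-≤-trans (+-monoʳ-< b i<L) (≤-trans b+L≤q (m≤m+n q _)) ,
    right<2m+1 i<L ,
    subst (_≤ m) (sym (slide-span _)) (m<1+n⇒m≤n (<-≤-trans (+-monoʳ-< g i<L) g+L≤1+m)))
    where
    right<2m+1 : ∀ {i} → i < L → q + 2 * i < 2 * m + 1
    right<2m+1 {i} i<L = ≤-pred (begin
      suc (suc (q + 2 * i))  ≡⟨ solve (q ∷ i ∷ []) ⟩
      q + 2 * suc i          ≤⟨ +-monoʳ-≤ q (*-monoʳ-≤ 2 i<L) ⟩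
      q + 2 * L              ≤⟨ q+2L≤2m+2 ⟩
      suc (2 * m + 1)        ∎)
      where open ≤-Reasoning

  slide-compatible : AllPairs Compatible (slide b q L)
  slide-compatible = AllPairs.map⁺ (AllPairs.applyUpTo⁺₁ id L compatible)
    where
    below-q : ∀ {i} → i < L → b + i < q
    below-q i<L = <-≤-trans (+-monoʳ-< b i<L) b+L≤q
    compatible : ∀ {i j} → i < j → j < L → Compatible (b + i , q + 2 * i) (b + j , q + 2 * j)
    compatible {i} {j} i<j j<L =
      (<⇒≢ (+-monoʳ-< b i<j) ,
       <⇒≢ (<-≤-trans (below-q (<-trans i<j j<L)) (m≤m+n q (2 * j))) ,
       ≢-sym (<⇒≢ (<-≤-trans (below-q j<L) (m≤m+n q (2 * i)))) ,
       <⇒≢ (+-monoʳ-< q (*-monoʳ-< 2 i<j))) ,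
      λ eq → <⇒≢ (+-monoʳ-< g i<j) (trans (sym (slide-span i)) (trans eq (slide-span j)))

dilate : ℕ → List Edge → List Edge
dilate s = map (λ e → (s + 2 * proj₁ e , s + 2 * proj₂ e))

DilateZone : ℕ → ℕ → Edge → Set
DilateZone s k (a , a′) = a ∈2ℕ+ s × a′ ∈2ℕ+ s × (a′ ∸ a) ∈2ℕ+ 0 × a′ ∸ a ≤ 2 * k

module _ (s : ℕ) where

  private
    dilate-span : ∀ a b → s + 2 * b ∸ (s + 2 * a) ≡ 2 * (b ∸ a)
    dilate-span a b = trans ([m+n]∸[m+o]≡n∸o s (2 * b) (2 * a)) (sym (*-distribˡ-∸ 2 b a))

    double-injective : ∀ {x y} → s + 2 * x ≡ s + 2 * y → x ≡ y
    double-injective {x} {y} eq = *-cancelˡ-≡ x y 2 (+-cancelˡ-≡ s _ _ eq)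

  dilate-zone : ∀ {k M} → All (Short k) M → All (DilateZone s k) (dilate s M)
  dilate-zone {k} = All.map⁺ ∘ All.map λ {(a , b)} (_ , _ , b∸a≤k) →
    (a , refl) , (b , refl) , (b ∸ a , dilate-span a b) ,
    subst (_≤ 2 * k) (sym (dilate-span a b)) (*-monoʳ-≤ 2 b∸a≤k)

  dilate-short : ∀ {k m M} → s + 4 * k ≤ 2 * m → 2 * k ≤ m →
                 All (Short k) M → All (Short m) (dilate s M)
  dilate-short {k} {m} s+4k≤2m 2k≤m = All.map⁺ ∘ All.map λ {(a , b)} (a<b , b<2k+1 , b∸a≤k) →
    +-monoʳ-< s (*-monoʳ-< 2 a<b) ,
    right<2m+1 b<2k+1 ,
    subst (_≤ m) (sym (dilate-span a b)) (≤-trans (*-monoʳ-≤ 2 b∸a≤k) 2k≤m)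
    where
    right<2m+1 : ∀ {b} → b < 2 * k + 1 → s + 2 * b < 2 * m + 1
    right<2m+1 {b} b<2k+1 = begin-strict
      s + 2 * b        ≤⟨ +-monoʳ-≤ s (*-monoʳ-≤ 2 b≤2k) ⟩
      s + 2 * (2 * k)  ≡⟨ cong (s +_) (solve (k ∷ [])) ⟩
      s + 4 * k        ≤⟨ s+4k≤2m ⟩
      2 * m            <⟨ m<m+n (2 * m) (s≤s z≤n) ⟩
      2 * m + 1        ∎
      where
      open ≤-Reasoning
      b≤2k : b ≤ 2 * k
      b≤2k = m<1+n⇒m≤n (subst (b <_) (+-comm (2 * k) 1) b<2k+1)

  dilate-compatible : ∀ {M} → AllPairs Compatible M → AllPairs Compatible (dilate s M)
  dilate-compatible = AllPairs.map⁺ ∘ AllPairs.map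
    λ {(a , b)} {(a′ , b′)} ((a≢a′ , a≢b′ , b≢a′ , b≢b′) , span≢) →
      (a≢a′ ∘ double-injective , a≢b′ ∘ double-injective ,
       b≢a′ ∘ double-injective , b≢b′ ∘ double-injective) ,
      λ eq → span≢ (*-cancelˡ-≡ (b ∸ a) (b′ ∸ a′) 2
                      (trans (sym (dilate-span a b)) (trans eq (dilate-span a′ b′))))

-- Ξ_n = arch c p ++ slide b q L ++ dilate s Ξ_{2k+1} for n = 2m + 1; g = q − b is the
-- shortest span of the slide. For p = 0 the value c = 2k ∸ 1 is junk, hence the guard on apex.
record Layout (m k p c b q g s L : ℕ) : Set where
  field
    apex      : 0 < p → c + 1 ≡ 2 * p
    b≡2p      : b ≡ 2 * p
    q≡b+g     : q ≡ b + g
    2p≤g      : 2 * p ≤ g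
    2k<g      : 2 * k < g
    L≤g       : L ≤ g
    b+L≤s     : b + L ≤ s
    q≡s±1     : q ≡ suc s ⊎ s ≡ suc q
    g+L≤1+m   : g + L ≤ suc m
    q+2L≤2m+2 : q + 2 * L ≤ suc (2 * m + 1)
    s+4k≤2m   : s + 4 * k ≤ 2 * m
    p+L+k≡m   : p + (L + k) ≡ m

module _ {m k p c b q g s L : ℕ} (layout : Layout m k p c b q g s L) where
  open Layout layout

  private
    b≤q : b ≤ q
    b≤q = subst (b ≤_) (sym q≡b+g) (m≤m+n b g)

    b≤s : b ≤ s
    b≤s = ≤-trans (m≤m+n b L) b+L≤s

    2k≤m : 2 * k ≤ m
    2k≤m = m<1+n⇒m≤n (≤-trans 2k<g (≤-trans (m≤m+n g L) g+L≤1+m))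

    arch-short : All (Short m) (arch c p)
    arch-short =
      All.map (λ (a<a′ , a′<2p , _) → short-below a<a′ (m<1+n⇒m≤n (<1+m a′<2p))) (arch-zone apex)
      where
      <1+m : ∀ {x} → x < 2 * p → x < suc m
      <1+m x<2p = <-≤-trans x<2p (≤-trans 2p≤g (≤-trans (m≤m+n g L) g+L≤1+m))

    arch-slide : ∀ {e f} → ArchZone p e → SlideZone b L q g f → Compatible e f
    arch-slide {a , a′} {c , c′} (a<a′ , a′<2p , _) (b≤c , _ , c′∈q+2ℕ , g≤span) =
      separated (<-trans a<a′ a′<b) a′<b b≤c (≤-trans b≤q (∈2ℕ+⇒≥ q c′∈q+2ℕ)) ,
      <⇒≢ (<-≤-trans (≤-<-trans (m∸n≤m a′ a) a′<2p) (≤-trans 2p≤g g≤span))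
      where
      a′<b : a′ < b
      a′<b = subst (a′ <_) (sym b≡2p) a′<2p

    arch-dilate : ∀ {e f} → ArchZone p e → DilateZone s k f → Compatible e f
    arch-dilate {a , a′} {c , c′} (a<a′ , a′<2p , odd) (c∈s+2ℕ , c′∈s+2ℕ , even , _) =
      separated (<-trans a<a′ a′<s) a′<s (∈2ℕ+⇒≥ s c∈s+2ℕ) (∈2ℕ+⇒≥ s c′∈s+2ℕ) ,
      λ eq → ∈2ℕ+-parity 0 even (subst (_∈2ℕ+ 1) eq odd)
      where
      a′<s : a′ < s
      a′<s = <-≤-trans (subst (a′ <_) (sym b≡2p) a′<2p) b≤s

    opposite-parity : ∀ {x y} → x ∈2ℕ+ q → y ∈2ℕ+ s → x ≢ y
    opposite-parity x∈q+2ℕ y∈s+2ℕ refl with q≡s±1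
    ... | inj₁ q≡1+s = ∈2ℕ+-parity s y∈s+2ℕ (subst (_ ∈2ℕ+_) q≡1+s x∈q+2ℕ)
    ... | inj₂ s≡1+q = ∈2ℕ+-parity q x∈q+2ℕ (subst (_ ∈2ℕ+_) s≡1+q y∈s+2ℕ)

    slide-dilate : ∀ {e f} → SlideZone b L q g e → DilateZone s k f → Compatible e f
    slide-dilate {a , a′} {c , c′}
      (_ , a<b+L , a′∈q+2ℕ , g≤span) (c∈s+2ℕ , c′∈s+2ℕ , _ , span≤2k) =
      (<⇒≢ (<-≤-trans a<s (∈2ℕ+⇒≥ s c∈s+2ℕ)) , <⇒≢ (<-≤-trans a<s (∈2ℕ+⇒≥ s c′∈s+2ℕ)) ,
       opposite-parity a′∈q+2ℕ c∈s+2ℕ , opposite-parity a′∈q+2ℕ c′∈s+2ℕ) ,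
      ≢-sym (<⇒≢ (≤-<-trans span≤2k (<-≤-trans 2k<g g≤span)))
      where
      a<s : a < s
      a<s = <-≤-trans a<b+L b+L≤s

  ars-step : ∀ {M} → ShortRainbow k M → ShortRainbow m (arch c p ++ slide b q L ++ dilate s M)
  ars-step {M} (short , compatible , length≡k) =
    All.++⁺ arch-short (All.++⁺ (slide-short q≡b+g L≤g g+L≤1+m q+2L≤2m+2)
                                (dilate-short s s+4k≤2m 2k≤m short)) ,
    AllPairs.++⁺ (arch-compatible apex)
      (AllPairs.++⁺ (slide-compatible q≡b+g L≤g) (dilate-compatible s compatible)
        (All.map (λ ze → All.map (slide-dilate ze) (dilate-zone s short)) (slide-zone q≡b+g L≤g)))
      (All.map (λ ze → All.++⁺ (All.map (arch-slide ze) (slide-zone q≡b+g L≤g))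
                               (All.map (arch-dilate ze) (dilate-zone s short)))
               (arch-zone apex)) ,
    (begin
      length (arch c p ++ slide b q L ++ dilate s M)
        ≡⟨ length-++ (arch c p) ⟩
      length (arch c p) + length (slide b q L ++ dilate s M)
        ≡⟨ cong (length (arch c p) +_) (length-++ (slide b q L)) ⟩
      length (arch c p) + (length (slide b q L) + length (dilate s M))
        ≡⟨ cong₂ _+_ (block-length p) (cong₂ _+_ (block-length L) (trans (length-map _ M) length≡k)) ⟩
      p + (L + k)
        ≡⟨ p+L+k≡m ⟩
      m ∎)
    where
    open ≡-Reasoning
    block-length : ∀ {f : ℕ → Edge} n → length (map f (upTo n)) ≡ n
    block-length {f} n = trans (length-map f (upTo n)) (length-upTo n)

layout₁ : ∀ k → Layout (4 * k) k k (2 * k ∸ 1) (2 * k) (4 * k + 1) (2 * k + 1) (4 * k) (2 * k)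
layout₁ k = record
  { apex      = λ 0<k → m∸n+n≡m (≤-trans 0<k (m≤m+n k (k + 0)))
  ; b≡2p      = refl
  ; q≡b+g     = solve (k ∷ [])
  ; 2p≤g      = m+o≡n⇒m≤n 1 (solve (k ∷ []))
  ; 2k<g      = m+o≡n⇒m≤n 0 (solve (k ∷ []))
  ; L≤g       = m+o≡n⇒m≤n 1 (solve (k ∷ []))
  ; b+L≤s     = m+o≡n⇒m≤n 0 (solve (k ∷ []))
  ; q≡s±1     = inj₁ (solve (k ∷ []))
  ; g+L≤1+m   = m+o≡n⇒m≤n 0 (solve (k ∷ []))
  ; q+2L≤2m+2 = m+o≡n⇒m≤n 1 (solve (k ∷ []))
  ; s+4k≤2m   = m+o≡n⇒m≤n 0 (solve (k ∷ []))
  ; p+L+k≡m   = solve (k ∷ [])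
  }

layout₃ : ∀ k → Layout (1 + 4 * k) k k (2 * k ∸ 1) (2 * k) (4 * k + 1) (2 * k + 1) (4 * k + 2) (2 * k + 1)
layout₃ k = record
  { apex      = λ 0<k → m∸n+n≡m (≤-trans 0<k (m≤m+n k (k + 0)))
  ; b≡2p      = refl
  ; q≡b+g     = solve (k ∷ [])
  ; 2p≤g      = m+o≡n⇒m≤n 1 (solve (k ∷ []))
  ; 2k<g      = m+o≡n⇒m≤n 0 (solve (k ∷ []))
  ; L≤g       = m+o≡n⇒m≤n 0 (solve (k ∷ []))
  ; b+L≤s     = m+o≡n⇒m≤n 1 (solve (k ∷ []))
  ; q≡s±1     = inj₂ (solve (k ∷ []))
  ; g+L≤1+m   = m+o≡n⇒m≤n 0 (solve (k ∷ []))
  ; q+2L≤2m+2 = m+o≡n⇒m≤n 1 (solve (k ∷ []))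
  ; s+4k≤2m   = m+o≡n⇒m≤n 0 (solve (k ∷ []))
  ; p+L+k≡m   = solve (k ∷ [])
  }

layout₅ : ∀ k → Layout (2 + 4 * k) k (k + 1) (2 * k + 1) (2 * k + 2) (4 * k + 4) (2 * k + 2)
                       (4 * k + 3) (2 * k + 1)
layout₅ k = record
  { apex      = λ _ → solve (k ∷ [])
  ; b≡2p      = solve (k ∷ [])
  ; q≡b+g     = solve (k ∷ [])
  ; 2p≤g      = m+o≡n⇒m≤n 0 (solve (k ∷ []))
  ; 2k<g      = m+o≡n⇒m≤n 1 (solve (k ∷ []))
  ; L≤g       = m+o≡n⇒m≤n 1 (solve (k ∷ []))
  ; b+L≤s     = m+o≡n⇒m≤n 0 (solve (k ∷ []))
  ; q≡s±1     = inj₁ (solve (k ∷ []))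
  ; g+L≤1+m   = m+o≡n⇒m≤n 0 (solve (k ∷ []))
  ; q+2L≤2m+2 = m+o≡n⇒m≤n 0 (solve (k ∷ []))
  ; s+4k≤2m   = m+o≡n⇒m≤n 1 (solve (k ∷ []))
  ; p+L+k≡m   = solve (k ∷ [])
  }

layout₇ : ∀ k → Layout (3 + 4 * k) k (k + 1) (2 * k + 1) (2 * k + 2) (4 * k + 4) (2 * k + 2)
                       (4 * k + 5) (2 * k + 2)
layout₇ k = record
  { apex      = λ _ → solve (k ∷ [])
  ; b≡2p      = solve (k ∷ [])
  ; q≡b+g     = solve (k ∷ [])
  ; 2p≤g      = m+o≡n⇒m≤n 0 (solve (k ∷ []))
  ; 2k<g      = m+o≡n⇒m≤n 1 (solve (k ∷ []))
  ; L≤g       = m+o≡n⇒m≤n 0 (solve (k ∷ []))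
  ; b+L≤s     = m+o≡n⇒m≤n 1 (solve (k ∷ []))
  ; q≡s±1     = inj₂ (solve (k ∷ []))
  ; g+L≤1+m   = m+o≡n⇒m≤n 0 (solve (k ∷ []))
  ; q+2L≤2m+2 = m+o≡n⇒m≤n 0 (solve (k ∷ []))
  ; s+4k≤2m   = m+o≡n⇒m≤n 1 (solve (k ∷ []))
  ; p+L+k≡m   = solve (k ∷ [])
  }

1+2m≢2r+8k : ∀ m r k → suc (2 * m) ≢ 2 * r + k * 8
1+2m≢2r+8k m r k eq = even≢odd (r + 4 * k) m (sym (trans eq (solve (r ∷ k ∷ []))))

1+2m≡1+2r+8k⇒m≡r+4k : ∀ m r k → suc (2 * m) ≡ suc (2 * r) + k * 8 → m ≡ r + 4 * k
1+2m≡1+2r+8k⇒m≡r+4k m r k eq = *-cancelˡ-≡ m (r + 4 * k) 2 (trans (suc-injective eq) (solve (r ∷ k ∷ [])))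

8k≤n⇒2k+1<n : ∀ {n} k → 2 ≤ n → k * 8 ≤ n → 2 * k + 1 < n
8k≤n⇒2k+1<n     zero    2≤n _    = 2≤n
8k≤n⇒2k+1<n {n} (suc k) _   8k≤n = begin-strict
  2 * suc k + 1  <⟨ m+o≡n⇒m≤n (6 * k + 4) (solve (k ∷ [])) ⟩
  suc k * 8      ≤⟨ 8k≤n ⟩
  n              ∎
  where open ≤-Reasoning

module _ (f x : ℕ) where

  private
    n k : ℕ
    n = suc (suc x)
    k = n / 8

  ARSfuel-step : ∀ {m} → n ≡ suc (2 * m) → ShortRainbow k (ARSfuel f (2 * k + 1)) →
                 ShortRainbow m (ARSfuel (suc f) n)
  ARSfuel-step {m} n≡1+2m IH with n % 8 | m%n<n n 8 | trans (sym n≡1+2m) (m≡m%n+[m/n]*n n 8)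
  ... | 0 | _ | eq = ⊥-elim (1+2m≢2r+8k m 0 k eq)
  ... | 2 | _ | eq = ⊥-elim (1+2m≢2r+8k m 1 k eq)
  ... | 4 | _ | eq = ⊥-elim (1+2m≢2r+8k m 2 k eq)
  ... | 6 | _ | eq = ⊥-elim (1+2m≢2r+8k m 3 k eq)
  ... | 1 | _ | eq =
    subst (λ m → ShortRainbow m _) (sym (1+2m≡1+2r+8k⇒m≡r+4k m 0 k eq)) (ars-step (layout₁ k) IH)
  ... | 3 | _ | eq =
    subst (λ m → ShortRainbow m _) (sym (1+2m≡1+2r+8k⇒m≡r+4k m 1 k eq)) (ars-step (layout₃ k) IH)
  ... | 5 | _ | eq =
    subst (λ m → ShortRainbow m _) (sym (1+2m≡1+2r+8k⇒m≡r+4k m 2 k eq)) (ars-step (layout₅ k) IH)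
  ... | 7 | _ | eq =
    subst (λ m → ShortRainbow m _) (sym (1+2m≡1+2r+8k⇒m≡r+4k m 3 k eq)) (ars-step (layout₇ k) IH)
  ... | suc (suc (suc (suc (suc (suc (suc (suc _))))))) | r<8 | _ = ⊥-elim (m+n≮m 8 _ r<8)

ARSfuel-shortRainbow : ∀ f {n m} → n ≡ suc (2 * m) → n ≤ f → ShortRainbow m (ARSfuel f n)
ARSfuel-shortRainbow zero    {zero}          ()
ARSfuel-shortRainbow zero    {suc _}         _ ()
ARSfuel-shortRainbow (suc f) {zero}          ()
ARSfuel-shortRainbow (suc f) {1}     {zero}  _ _ = All.[] , AllPairs.[] , refl
ARSfuel-shortRainbow (suc f) {1}     {suc _} ()
ARSfuel-shortRainbow (suc f) {n@(suc (suc x))} n≡1+2m n≤1+f =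
  ARSfuel-step f x n≡1+2m (ARSfuel-shortRainbow f (+-comm (2 * k) 1) 2k+1≤f)
  where
  k : ℕ
  k = n / 8
  2k+1≤f : 2 * k + 1 ≤ f
  2k+1≤f = ≤-pred (≤-trans (8k≤n⇒2k+1<n k (s≤s (s≤s z≤n)) (m/n*n≤m n 8)) n≤1+f)

theorem3 : (m : ℕ) → IsRainbowNearPerfectMatching (2 * m + 1) (ARS (2 * m + 1))
theorem3 m =
  shortRainbow⇒rainbowNearPerfect {m} (ARSfuel-shortRainbow (2 * m + 1) (+-comm (2 * m) 1) ≤-refl)
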